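{- Let $n\geq 2$ and $d\geq 1$ be integers. For $d\geq 2$ and $0\leq k\leq nd$ define matrices $A_k^{(n,d)}$ with entries in $\{0,1,\ldots,n\}$ and $d$ columns recursively as follows, where $A_i^{(n,1)}=[i]$ for $0\leq i\leq n$, and $\mathbf{k}$ denotes a column vector all of whose entries equal $k$ (of the appropriate length): (1) $A_0^{(n,d)}=[0\ 0\ \cdots\ 0]$; (2) for $1\leq k\leq n-1$, $A_k^{(n,d)}$ is the vertical concatenation of the blocks $[A_0^{(n,d-1)}\ \mathbf{k}],[A_1^{(n,d-1)}\ \mathbf{k-1}],\ldots,[A_k^{(n,d-1)}\ \mathbf{0}]$ (in this order, top to bottom); (3) for $n\leq k\leq nd-n$, $A_k^{(n,d)}$ is the vertical concatenation of $[A_{k-n}^{(n,d-1)}\ \mathbf{n}],[A_{k-n+1}^{(n,d-1)}\ \mathbf{n-1}],\ldots,[A_k^{(n,d-1)}\ \mathbf{0}]$; (4) for $nd-n+1\leq k\leq nd-1$, $A_k^{(n,d)}$ is the vertical concatenation of $[A_{k-n}^{(n,d-1)}\ \mathbf{n}],[A_{k-n+1}^{(n,d-1)}\ \mathbf{n-1}],\ldots,[A_{nd-n}^{(n,d-1)}\ \mathbf{k+n-nd}]$; (5) $A_{nd}^{(n,d)}=[n\ n\ \cdots\ n]$. Let $H_n^d$ be the $(n+1)^d\times d$ matrix obtained by stacking $A_0^{(n,d)},A_1^{(n,d)},\ldots,A_{nd}^{(n,d)}$ from top to bottom. Then the rows of $H_n^d$, read from top to bottom, list all vertices of $P_n^d$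 (each exactly once) in increasing Hales order.
   Context: $P_n^d$ is the graph with vertex set $\{0,1,\ldots,n\}^d$, two vertices being adjacent iff they differ in exactly one coordinate, and there by absolute difference $1$. The weight $w(x)$ of $x\in\{0,\ldots,n\}^d$ is the sum of its coordinates. The Hales order on $\{0,\ldots,n\}^d$: $u\leq v$ iff either $w(u)<w(v)$, or $w(u)=w(v)$ and $u$ is greater than or equal to $v$ in the lexicographic order that compares coordinates from right to left (i.e., last coordinate first). For example, for $n=d=2$ the order is $00<01<10<02<11<20<12<21<22$. -}

module Defs where

open import Data.Nat using (ℕ; zero; suc; _+_; _*_; _∸_; _<_; _≤_; _>_; _≡ᵇ_; _<ᵇ_; _≤ᵇ_)
open import Data.Bool using (if_then_else_)
open import Data.List using (List; []; _∷_; map; concatMap; upTo)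
open import Data.Vec using (Vec; []; _∷_; _∷ʳ_; replicate; reverse; sum)
open import Data.Product using (_×_)
open import Data.Sum using (_⊎_)
open import Data.Unit using (⊤)
open import Data.Empty using (⊥)
open import Relation.Binary.PropositionalEquality using (_≡_; _≢_)

appendCol : ∀ {m} → ℕ → List (Vec ℕ m) → List (Vec ℕ (suc m))
appendCol c = map (λ r → r ∷ʳ c)

-- One recursion step: given n, e (so that d = e + 1 is the new number of
-- columns and e the previous one, e ≥ 1) and the previous-level matrices
-- prev i = A_i^{(n,e)}, compute A_k^{(n,e+1)} following cases (1)-(5).
step : (n e : ℕ) → (ℕ → List (Vec ℕ e)) → ℕ → List (Vec ℕ (suc e))
step n e prev k =
  if k ≡ᵇ 0 then replicate D 0 ∷ []
  else if k <ᵇ n then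
    concatMap (λ i → block i (k ∸ i)) (upTo (suc k))
  else if k ≤ᵇ nD ∸ n then
    concatMap (λ j → block (k ∸ n + j) (n ∸ j)) (upTo (suc n))
  else if k <ᵇ nD then
    -- (4) blocks [A_{k-n+j}^{(n,d-1)} (n-j)] for j = 0,...,nd-k
    -- (last block: [A_{nd-n}^{(n,d-1)} (k+n-nd)])
    concatMap (λ j → block (k ∸ n + j) (n ∸ j)) (upTo (suc (nD ∸ k)))
  else if k ≡ᵇ nD then replicate D n ∷ []
  else []
  where
  D : ℕ
  D = suc e
  nD : ℕ
  nD = n * D
  block : ℕ → ℕ → List (Vec ℕ D)
  block i c = appendCol c (prev i)

-- A n d k : the matrix A_k^{(n,d)}, as a list of rows (top to bottom);
-- each row is a vector of length d. (d = 0 is not used; gives [].)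
A : (n d : ℕ) → ℕ → List (Vec ℕ d)
A n zero k = []
A n (suc zero) k = if k ≤ᵇ n then (k ∷ []) ∷ [] else []
A n (suc (suc e)) k = step n (suc e) (A n (suc e)) k

H : (n d : ℕ) → List (Vec ℕ d)
H n d = concatMap (A n d) (upTo (suc (n * d)))

w : ∀ {d} → Vec ℕ d → ℕ
w = sum

LexGE : ∀ {d} → Vec ℕ d → Vec ℕ d → Set
LexGE [] [] = ⊤
LexGE (x ∷ xs) (y ∷ ys) = x > y ⊎ (x ≡ y × LexGE xs ys)

RevLexGE : ∀ {d} → Vec ℕ d → Vec ℕ d → Set
RevLexGE u v = LexGE (reverse u) (reverse v)

_≤H_ : ∀ {d} → Vec ℕ d → Vec ℕ d → Set
u ≤H v = w u < w v ⊎ (w u ≡ w v × RevLexGE u v)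

_<H_ : ∀ {d} → Vec ℕ d → Vec ℕ d → Set
u <H v = u ≤H v × u ≢ v

-- Let level d k list the vertices of weight k by decreasing last coordinate c, the block for c
-- being level (d-1) (k-c) with c appended. By induction on d it is sorted in Hales order and
-- consists exactly of the vertices of weight k, and summing over k and c gives (n+1)^d vertices.
-- The paper's A_k^(n,d) is level d k: the blocks omitted in (2) and (4) are those with c > k or
-- k - c > n(d-1), which are empty, while (1) and (5) are the one-vertex levels k = 0 and k = nd.
-- So H_n^d is the concatenation of the levels in increasing weight.
module Submission where

open import Defs
open import Data.Nat using (ℕ; zero; suc; _+_; _*_; _∸_; _^_; _≤_; _<_; _≤ᵇ_; _<ᵇ_; _≡ᵇ_; z≤n; s≤s; z<s; s<s)
open import Data.Nat.Properties
open import Data.Bool using (true; false)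
open import Data.List using (List; []; _∷_; _++_; [_]; concat; concatMap; upTo; applyUpTo; length)
open import Data.List.Properties using (length-map; length-++; map-upTo; concat-++; ++-identityʳ)
open import Data.List.Membership.Propositional using (_∈_)
open import Data.List.Membership.Propositional.Properties using (∈-map⁺; ∈-map⁻; ∈-concat⁺′; ∈-applyUpTo⁺)
open import Data.List.Relation.Unary.Any using (here)
open import Data.List.Relation.Unary.All as All using (All; []; _∷_)
import Data.List.Relation.Unary.All.Properties as All
open import Data.List.Relation.Unary.AllPairs as AllPairs using (AllPairs; []; _∷_)
import Data.List.Relation.Unary.AllPairs.Properties as AllPairs
open import Data.List.Relation.Unary.Linked using (Linked)
open import Data.List.Relation.Unary.Linked.Properties using (AllPairs⇒Linked)
open import Data.Vec using (Vec; []; _∷_; _∷ʳ_; replicate; reverse; initLast)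
open import Data.Vec.Properties using (reverse-∷; ∷ʳ-injectiveˡ; ∷ʳ-injectiveʳ)
import Data.Vec.Relation.Unary.All as VAll
open import Data.Product as Product using (_×_; _,_; proj₁; proj₂)
open import Data.Sum using (inj₁; inj₂)
open import Data.Empty using (⊥-elim)
open import Function using (_∘_)
open import Relation.Nullary using (¬_)
open import Relation.Nullary.Reflects using (ofʸ; ofⁿ; fromEquivalence)
open import Relation.Binary.PropositionalEquality using (_≡_; refl; sym; trans; cong; cong₂; subst; subst₂)
open Relation.Binary.PropositionalEquality.≡-Reasoning
open import Algebra.Properties.CommutativeSemigroup +-commutativeSemigroup using () renaming (interchange to +-interchange)

module _ {A : Set} where

  applyUpTo-+ : ∀ (f : ℕ → A) a b → applyUpTo f (a + b) ≡ applyUpTo f a ++ applyUpTo (f ∘ (a +_)) b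
  applyUpTo-+ f zero    b = refl
  applyUpTo-+ f (suc a) b = cong (f 0 ∷_) (applyUpTo-+ (f ∘ suc) a b)

  applyUpTo-cong : ∀ {f g : ℕ → A} N → (∀ i → i < N → f i ≡ g i) → applyUpTo f N ≡ applyUpTo g N
  applyUpTo-cong zero    f≗g = refl
  applyUpTo-cong (suc N) f≗g = cong₂ _∷_ (f≗g 0 z<s) (applyUpTo-cong N (λ i i<N → f≗g (suc i) (s<s i<N)))

  sorted-constant⇒singleton : ∀ {R : A → A → Set} {xs z} → (∀ {x} → ¬ R x x) →
    AllPairs R xs → All (_≡ z) xs → z ∈ xs → xs ≡ [ z ]
  sorted-constant⇒singleton irr (_ ∷ [])        (refl ∷ [])       _ = refl
  sorted-constant⇒singleton irr ((Rxy ∷ _) ∷ _) (refl ∷ refl ∷ _) _ = ⊥-elim (irr Rxy)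

  All-absurd⇒[] : ∀ {P : A → Set} {xs} → (∀ {x} → ¬ P x) → All P xs → xs ≡ []
  All-absurd⇒[] ¬P []       = refl
  All-absurd⇒[] ¬P (px ∷ _) = ⊥-elim (¬P px)

module _ {A : Set} where

  concat-applyUpTo-+ : ∀ (f : ℕ → List A) a b →
    concat (applyUpTo f (a + b)) ≡ concat (applyUpTo f a) ++ concat (applyUpTo (f ∘ (a +_)) b)
  concat-applyUpTo-+ f a b = trans (cong concat (applyUpTo-+ f a b)) (sym (concat-++ (applyUpTo f a) _))

  concat-applyUpTo-[] : ∀ (f : ℕ → List A) N → (∀ i → i < N → f i ≡ []) → concat (applyUpTo f N) ≡ []
  concat-applyUpTo-[] f zero    _    = refl
  concat-applyUpTo-[] f (suc N) f≡[] =
    cong₂ _++_ (f≡[] 0 z<s) (concat-applyUpTo-[] (f ∘ suc) N (λ i i<N → f≡[] (suc i) (s<s i<N)))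

  concat-applyUpTo-trim : ∀ (f g : ℕ → List A) {N} a m b → N ≡ a + m + b →
    (∀ i → i < a → f i ≡ []) →
    (∀ i → i < m → f (a + i) ≡ g i) →
    (∀ i → i < b → f (a + m + i) ≡ []) →
    concat (applyUpTo f N) ≡ concatMap g (upTo m)
  concat-applyUpTo-trim f g a m b refl front middle back = begin
    concat (applyUpTo f (a + m + b))
      ≡⟨ concat-applyUpTo-+ f (a + m) b ⟩
    concat (applyUpTo f (a + m)) ++ concat (applyUpTo (f ∘ (a + m +_)) b)
      ≡⟨ cong₂ _++_ (concat-applyUpTo-+ f a m) (concat-applyUpTo-[] _ b back) ⟩
    (concat (applyUpTo f a) ++ concat (applyUpTo (f ∘ (a +_)) m)) ++ []
      ≡⟨ ++-identityʳ _ ⟩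
    concat (applyUpTo f a) ++ concat (applyUpTo (f ∘ (a +_)) m)
      ≡⟨ cong₂ _++_ (concat-applyUpTo-[] f a front) (cong concat (applyUpTo-cong m middle)) ⟩
    concat (applyUpTo g m)
      ≡⟨ cong concat (map-upTo g m) ⟨
    concatMap g (upTo m) ∎

  AllPairs-concat-applyUpTo : ∀ {R : A → A → Set} (f : ℕ → List A) N → (∀ i → AllPairs R (f i)) →
    (∀ {i j x y} → i < j → j < N → x ∈ f i → y ∈ f j → R x y) → AllPairs R (concat (applyUpTo f N))
  AllPairs-concat-applyUpTo f N within across =
    AllPairs.concat⁺ (All.applyUpTo⁺₂ f N within)
      (AllPairs.applyUpTo⁺₁ f N (λ i<j j<N →
        All.tabulate (λ x∈ → All.tabulate (λ y∈ → across i<j j<N x∈ y∈))))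

module _ {A : Set} where

  -- shift c p k is p (k ∸ c) for c ≤ k but [] for k < c, where truncated subtraction would give p 0.
  shift : ℕ → (ℕ → List A) → ℕ → List A
  shift zero    p k       = p k
  shift (suc c) p zero    = []
  shift (suc c) p (suc k) = shift c p k

  shift-+ : ∀ c (p : ℕ → List A) k → shift c p (c + k) ≡ p k
  shift-+ zero    p k = refl
  shift-+ (suc c) p k = shift-+ c p k

  shift-≤ : ∀ (p : ℕ → List A) {c k} → c ≤ k → shift c p k ≡ p (k ∸ c)
  shift-≤ p {c} {k} c≤k = begin
    shift c p k             ≡⟨ cong (shift c p) (m+[n∸m]≡n c≤k) ⟨
    shift c p (c + (k ∸ c)) ≡⟨ shift-+ c p (k ∸ c) ⟩
    p (k ∸ c)               ∎

  shift-> : ∀ (p : ℕ → List A) {c k} → k < c → shift c p k ≡ []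
  shift-> p {suc c} {zero}  _         = refl
  shift-> p {suc c} {suc k} (s<s k<c) = shift-> p k<c

  shift-preserves : ∀ (P : List A → Set) {p : ℕ → List A} → P [] → (∀ i → P (p i)) → ∀ c k → P (shift c p k)
  shift-preserves P P[] Pp zero    k       = Pp k
  shift-preserves P P[] Pp (suc c) zero    = P[]
  shift-preserves P P[] Pp (suc c) (suc k) = shift-preserves P P[] Pp c k

  ∈-shift⁻ : ∀ c (p : ℕ → List A) k {x} → x ∈ shift c p k → c ≤ k × x ∈ p (k ∸ c)
  ∈-shift⁻ zero    p k       x∈ = z≤n , x∈
  ∈-shift⁻ (suc c) p (suc k) x∈ = Product.map₁ s≤s (∈-shift⁻ c p k x∈)

∑< : ℕ → (ℕ → ℕ) → ℕ
∑< zero    f = 0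
∑< (suc N) f = f 0 + ∑< N (f ∘ suc)

∑<-cong : ∀ N {f g : ℕ → ℕ} → (∀ i → i < N → f i ≡ g i) → ∑< N f ≡ ∑< N g
∑<-cong zero    f≗g = refl
∑<-cong (suc N) f≗g = cong₂ _+_ (f≗g 0 z<s) (∑<-cong N (λ i i<N → f≗g (suc i) (s<s i<N)))

∑<-const : ∀ N c → ∑< N (λ _ → c) ≡ N * c
∑<-const zero    c = refl
∑<-const (suc N) c = cong (c +_) (∑<-const N c)

∑<-+ : ∀ N (f g : ℕ → ℕ) → ∑< N (λ i → f i + g i) ≡ ∑< N f + ∑< N g
∑<-+ zero    f g = refl
∑<-+ (suc N) f g =
  trans (cong (f 0 + g 0 +_) (∑<-+ N (f ∘ suc) (g ∘ suc))) (+-interchange (f 0) (g 0) _ _)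

∑<-swap : ∀ M N (g : ℕ → ℕ → ℕ) → ∑< N (λ k → ∑< M (λ j → g j k)) ≡ ∑< M (λ j → ∑< N (g j))
∑<-swap zero    N g = trans (∑<-const N 0) (*-zeroʳ N)
∑<-swap (suc M) N g =
  trans (∑<-+ N (g 0) (λ k → ∑< M (λ j → g (suc j) k))) (cong (∑< N (g 0) +_) (∑<-swap M N (g ∘ suc)))

length-concat-applyUpTo : ∀ {A : Set} (f : ℕ → List A) N → length (concat (applyUpTo f N)) ≡ ∑< N (length ∘ f)
length-concat-applyUpTo f zero    = refl
length-concat-applyUpTo f (suc N) =
  trans (length-++ (f 0)) (cong (length (f 0) +_) (length-concat-applyUpTo (f ∘ suc) N))

∑<-length-shift : ∀ {A : Set} c (p : ℕ → List A) N → ∑< N (length ∘ shift c p) ≡ ∑< (N ∸ c) (length ∘ p)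
∑<-length-shift zero    p N       = refl
∑<-length-shift (suc c) p zero    = refl
∑<-length-shift (suc c) p (suc N) = ∑<-length-shift c p N

reverse-∷ʳ : ∀ {A : Set} {m} (xs : Vec A m) x → reverse (xs ∷ʳ x) ≡ x ∷ reverse xs
reverse-∷ʳ []       x = refl
reverse-∷ʳ (y ∷ xs) x = begin
  reverse (y ∷ (xs ∷ʳ x)) ≡⟨ reverse-∷ y (xs ∷ʳ x) ⟩
  reverse (xs ∷ʳ x) ∷ʳ y  ≡⟨ cong (_∷ʳ y) (reverse-∷ʳ xs x) ⟩
  x ∷ (reverse xs ∷ʳ y)   ≡⟨ cong (x ∷_) (reverse-∷ y xs) ⟨
  x ∷ reverse (y ∷ xs)    ∎

w-∷ʳ : ∀ {m} (xs : Vec ℕ m) x → w (xs ∷ʳ x) ≡ w xs + x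
w-∷ʳ []       x = +-identityʳ x
w-∷ʳ (y ∷ xs) x = trans (cong (y +_) (w-∷ʳ xs x)) (sym (+-assoc y (w xs) x))

w-replicate : ∀ m c → w (replicate m c) ≡ m * c
w-replicate zero    c = refl
w-replicate (suc m) c = cong (c +_) (w-replicate m c)

module _ {P : ℕ → Set} where

  All-∷ʳ⁺ : ∀ {m} {xs : Vec ℕ m} {x} → VAll.All P xs → P x → VAll.All P (xs ∷ʳ x)
  All-∷ʳ⁺ VAll.[]         px = px VAll.∷ VAll.[]
  All-∷ʳ⁺ (py VAll.∷ pys) px = py VAll.∷ All-∷ʳ⁺ pys px

  All-∷ʳ⁻ : ∀ {m} (xs : Vec ℕ m) {x} → VAll.All P (xs ∷ʳ x) → VAll.All P xs × P x
  All-∷ʳ⁻ []       (px VAll.∷ VAll.[]) = VAll.[] , px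
  All-∷ʳ⁻ (y ∷ xs) (py VAll.∷ pys)     = Product.map₁ (py VAll.∷_) (All-∷ʳ⁻ xs pys)

  All-replicate : ∀ m {c} → P c → VAll.All P (replicate m c)
  All-replicate zero    pc = VAll.[]
  All-replicate (suc m) pc = pc VAll.∷ All-replicate m pc

w≤n*length : ∀ {n m} {v : Vec ℕ m} → VAll.All (_≤ n) v → w v ≤ n * m
w≤n*length VAll.[] = z≤n
w≤n*length {n} {suc m} {x ∷ xs} (x≤n VAll.∷ xs≤n) =
  subst (x + w xs ≤_) (sym (*-suc n m)) (+-mono-≤ x≤n (w≤n*length xs≤n))

w≡0⇒≡replicate : ∀ {m} (v : Vec ℕ m) → w v ≡ 0 → v ≡ replicate m 0
w≡0⇒≡replicate []       _   = refl
w≡0⇒≡replicate (x ∷ xs) w≡0 =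
  cong₂ _∷_ (m+n≡0⇒m≡0 x w≡0) (w≡0⇒≡replicate xs (m+n≡0⇒n≡0 x w≡0))

w≡n*length⇒≡replicate : ∀ {n m} {v : Vec ℕ m} → VAll.All (_≤ n) v → w v ≡ n * m → v ≡ replicate m n
w≡n*length⇒≡replicate VAll.[] _ = refl
w≡n*length⇒≡replicate {n} {suc m} {x ∷ xs} (x≤n VAll.∷ xs≤n) eq =
  cong₂ _∷_ x≡n (w≡n*length⇒≡replicate xs≤n (+-cancelˡ-≡ n _ _ (trans (cong (_+ w xs) (sym x≡n)) eq′)))
  where
  eq′ : x + w xs ≡ n + n * m
  eq′ = trans eq (*-suc n m)
  x≡n : x ≡ n
  x≡n = ≤-antisym x≤n (≮⇒≥ (λ x<n → <-irrefl eq′ (+-mono-<-≤ x<n (w≤n*length xs≤n))))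

w<w⇒<H : ∀ {m} {u v : Vec ℕ m} → w u < w v → u <H v
w<w⇒<H wu<wv = inj₁ wu<wv , λ { refl → <-irrefl refl wu<wv }

∷ʳ-mono-<H : ∀ {m} {u v : Vec ℕ m} c → u <H v → (u ∷ʳ c) <H (v ∷ʳ c)
∷ʳ-mono-<H {u = u} {v} c (u≤v , u≢v) = ≤H u≤v , u≢v ∘ ∷ʳ-injectiveˡ u v
  where
  w-∷ʳ-cong : w u ≡ w v → w (u ∷ʳ c) ≡ w (v ∷ʳ c)
  w-∷ʳ-cong wu≡wv = trans (w-∷ʳ u c) (trans (cong (_+ c) wu≡wv) (sym (w-∷ʳ v c)))
  ≤H : u ≤H v → (u ∷ʳ c) ≤H (v ∷ʳ c)
  ≤H (inj₁ wu<wv)        = inj₁ (subst₂ _<_ (sym (w-∷ʳ u c)) (sym (w-∷ʳ v c)) (+-monoˡ-< c wu<wv))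
  ≤H (inj₂ (wu≡wv , ge)) =
    inj₂ (w-∷ʳ-cong wu≡wv , subst₂ LexGE (sym (reverse-∷ʳ u c)) (sym (reverse-∷ʳ v c)) (inj₂ (refl , ge)))

∷ʳ-<H : ∀ {m} (u v : Vec ℕ m) {c c′} → w (u ∷ʳ c) ≡ w (v ∷ʳ c′) → c′ < c → (u ∷ʳ c) <H (v ∷ʳ c′)
∷ʳ-<H u v {c} {c′} same-w c′<c =
  inj₂ (same-w , subst₂ LexGE (sym (reverse-∷ʳ u c)) (sym (reverse-∷ʳ v c′)) (inj₁ c′<c)) ,
  λ eq → <-irrefl (sym (∷ʳ-injectiveʳ u v eq)) c′<c

module Levels (n : ℕ) where

  Vertex : ∀ {d} → Vec ℕ d → Set
  Vertex = VAll.All (_≤ n)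

  VertexOfWeight : ∀ {d} → ℕ → Vec ℕ d → Set
  VertexOfWeight k v = Vertex v × w v ≡ k

  layer : ∀ {e} → (ℕ → List (Vec ℕ e)) → ℕ → ℕ → List (Vec ℕ (suc e))
  layer p k c = appendCol c (shift c p k)

  level : (d : ℕ) → ℕ → List (Vec ℕ d)
  level zero    zero    = [ [] ]
  level zero    (suc k) = []
  level (suc e) k       = concat (applyUpTo (λ j → layer (level e) k (n ∸ j)) (suc n))

  layer-sound : ∀ {e} (p : ℕ → List (Vec ℕ e)) → (∀ i → All (VertexOfWeight i) (p i)) →
    ∀ k {c} → c ≤ n → All (VertexOfWeight k) (layer p k c)
  layer-sound p p-sound k {c} c≤n = All.map⁺ (All.tabulate row)
    where
    row : ∀ {r} → r ∈ shift c p k → VertexOfWeight k (r ∷ʳ c)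
    row {r} r∈ with ∈-shift⁻ c p k r∈
    ... | c≤k , r∈′ with All.lookup (p-sound (k ∸ c)) r∈′
    ... | r-vertex , wr≡ =
      All-∷ʳ⁺ r-vertex c≤n , trans (w-∷ʳ r c) (trans (cong (_+ c) wr≡) (m∸n+n≡m c≤k))

  level-sound : ∀ d k → All (VertexOfWeight k) (level d k)
  level-sound zero    zero    = (VAll.[] , refl) ∷ []
  level-sound zero    (suc k) = []
  level-sound (suc e) k       =
    All.concat⁺ (All.applyUpTo⁺₂ _ (suc n) (λ j → layer-sound (level e) (level-sound e) k (m∸n≤m n j)))

  level-complete : ∀ {d} (v : Vec ℕ d) → Vertex v → v ∈ level d (w v)
  level-complete [] _ = here refl
  level-complete {suc e} v v-vertex with initLast v
  ... | r , c , refl with All-∷ʳ⁻ r v-vertex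
  ... | r-vertex , c≤n =
    subst (λ k → r ∷ʳ c ∈ level (suc e) k) (sym (w-∷ʳ r c))
      (∈-concat⁺′ ∈layer (∈-applyUpTo⁺ (λ j → layer (level e) (w r + c) (n ∸ j)) (s≤s (m∸n≤m n c))))
    where
    ∈shift : r ∈ shift c (level e) (w r + c)
    ∈shift = subst (λ k → r ∈ shift c (level e) k) (+-comm c (w r))
               (subst (r ∈_) (sym (shift-+ c (level e) (w r))) (level-complete r r-vertex))
    ∈layer : r ∷ʳ c ∈ layer (level e) (w r + c) (n ∸ (n ∸ c))
    ∈layer rewrite m∸[m∸n]≡n c≤n = ∈-map⁺ (_∷ʳ c) ∈shift

  level-sorted : ∀ d k → AllPairs _<H_ (level d k)
  level-sorted zero    zero    = [] ∷ []
  level-sorted zero    (suc k) = []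
  level-sorted (suc e) k       = AllPairs-concat-applyUpTo _ (suc n) within across
    where
    within : ∀ j → AllPairs _<H_ (layer (level e) k (n ∸ j))
    within j = AllPairs.map⁺ (AllPairs.map (∷ʳ-mono-<H (n ∸ j))
                 (shift-preserves (AllPairs _<H_) [] (level-sorted e) (n ∸ j) k))
    weight : ∀ {i x} → x ∈ layer (level e) k (n ∸ i) → w x ≡ k
    weight {i} x∈ = proj₂ (All.lookup (layer-sound (level e) (level-sound e) k (m∸n≤m n i)) x∈)
    across : ∀ {i j x y} → i < j → j < suc n →
      x ∈ layer (level e) k (n ∸ i) → y ∈ layer (level e) k (n ∸ j) → x <H y
    across {i} {j} i<j j<1+n x∈ y∈ with ∈-map⁻ (_∷ʳ (n ∸ i)) x∈ | ∈-map⁻ (_∷ʳ (n ∸ j)) y∈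
    ... | r , _ , refl | r′ , _ , refl =
      ∷ʳ-<H r r′ (trans (weight {i} x∈) (sym (weight {j} y∈))) (∸-monoʳ-< i<j (≤-pred j<1+n))

  level-singleton : ∀ {d k} (z : Vec ℕ d) → Vertex z → w z ≡ k →
    (∀ {v} → VertexOfWeight k v → v ≡ z) → level d k ≡ [ z ]
  level-singleton {d} z z-vertex refl unique =
    sorted-constant⇒singleton (λ x<Hx → proj₂ x<Hx refl) (level-sorted d (w z))
      (All.map unique (level-sound d (w z))) (level-complete z z-vertex)

  level-empty : ∀ d {k} → n * d < k → level d k ≡ []
  level-empty d n*d<k =
    All-absurd⇒[] (λ (v-vertex , wv≡k) → <⇒≱ n*d<k (subst (_≤ n * d) wv≡k (w≤n*length v-vertex)))
      (level-sound d _)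

  level-zero : ∀ d → level d 0 ≡ [ replicate d 0 ]
  level-zero d = level-singleton (replicate d 0) (All-replicate d z≤n) (trans (w-replicate d 0) (*-zeroʳ d))
    (λ {v} (_ , wv≡0) → w≡0⇒≡replicate v wv≡0)

  level-full : ∀ d → level d (n * d) ≡ [ replicate d n ]
  level-full d = level-singleton (replicate d n) (All-replicate d ≤-refl) (trans (w-replicate d n) (*-comm d n))
    (λ (v-vertex , wv≡) → w≡n*length⇒≡replicate v-vertex wv≡)

  level-one : ∀ {k} → k ≤ n → level 1 k ≡ [ k ∷ [] ]
  level-one {k} k≤n = level-singleton (k ∷ []) (k≤n VAll.∷ VAll.[]) (+-identityʳ k)
    (λ { {x ∷ []} (_ , x+0≡k) → cong (_∷ []) (trans (sym (+-identityʳ x)) x+0≡k) })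

  layer-below : ∀ d k {c} → n * d + c < k → layer (level d) k c ≡ []
  layer-below d k {c} n*d+c<k = cong (appendCol c) (begin
    shift c (level d) k ≡⟨ shift-≤ (level d) (≤-trans (m≤n+m c (n * d)) (<⇒≤ n*d+c<k)) ⟩
    level d (k ∸ c)     ≡⟨ level-empty d (m+n≤o⇒m≤o∸n (suc (n * d)) n*d+c<k) ⟩
    []                  ∎)

  ∑<-length-level : ∀ d M → n * d < M → ∑< M (length ∘ level d) ≡ suc n ^ d
  ∑<-length-level zero    (suc M) _     = cong suc (trans (∑<-const M 0) (*-zeroʳ M))
  ∑<-length-level (suc e) M       nd<M  = begin
    ∑< M (λ k → length (level (suc e) k))
      ≡⟨ ∑<-cong M (λ k _ → length-concat-applyUpTo (λ j → layer (level e) k (n ∸ j)) (suc n)) ⟩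
    ∑< M (λ k → ∑< (suc n) (λ j → length (layer (level e) k (n ∸ j))))
      ≡⟨ ∑<-swap (suc n) M (λ j k → length (layer (level e) k (n ∸ j))) ⟩
    ∑< (suc n) (λ j → ∑< M (λ k → length (layer (level e) k (n ∸ j))))
      ≡⟨ ∑<-cong (suc n) (λ j _ → column j) ⟩
    ∑< (suc n) (λ _ → suc n ^ e)
      ≡⟨ ∑<-const (suc n) (suc n ^ e) ⟩
    suc n * suc n ^ e ∎
    where
    room : ∀ j → n * e < M ∸ (n ∸ j)
    room j = m+n≤o⇒m≤o∸n (suc (n * e)) (≤-trans (+-monoʳ-≤ (suc (n * e)) (m∸n≤m n j))
               (subst (_≤ M) (cong suc (trans (*-suc n e) (+-comm n (n * e)))) nd<M))
    column : ∀ j → ∑< M (λ k → length (layer (level e) k (n ∸ j))) ≡ suc n ^ e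
    column j = begin
      ∑< M (λ k → length (layer (level e) k (n ∸ j)))
        ≡⟨ ∑<-cong M (λ k _ → length-map _ (shift (n ∸ j) (level e) k)) ⟩
      ∑< M (length ∘ shift (n ∸ j) (level e))
        ≡⟨ ∑<-length-shift (n ∸ j) (level e) M ⟩
      ∑< (M ∸ (n ∸ j)) (length ∘ level e)
        ≡⟨ ∑<-length-level e (M ∸ (n ∸ j)) (room j) ⟩
      suc n ^ e ∎

  levels : (d : ℕ) → List (Vec ℕ d)
  levels d = concat (applyUpTo (level d) (suc (n * d)))

  levels-complete : ∀ {d} (v : Vec ℕ d) → Vertex v → v ∈ levels d
  levels-complete {d} v v-vertex =
    ∈-concat⁺′ (level-complete v v-vertex) (∈-applyUpTo⁺ (level d) (s≤s (w≤n*length v-vertex)))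

  levels-vertices : ∀ d → All Vertex (levels d)
  levels-vertices d =
    All.concat⁺ (All.applyUpTo⁺₂ (level d) (suc (n * d)) (λ k → All.map proj₁ (level-sound d k)))

  levels-sorted : ∀ d → AllPairs _<H_ (levels d)
  levels-sorted d = AllPairs-concat-applyUpTo (level d) (suc (n * d)) (level-sorted d) across
    where
    across : ∀ {i j x y} → i < j → j < suc (n * d) → x ∈ level d i → y ∈ level d j → x <H y
    across {i} {j} i<j _ x∈ y∈ = w<w⇒<H (subst₂ _<_ (sym (weight i x∈)) (sym (weight j y∈)) i<j)
      where
      weight : ∀ k {x} → x ∈ level d k → w x ≡ k
      weight k x∈ = proj₂ (All.lookup (level-sound d k) x∈)

  length-levels : ∀ d → length (levels d) ≡ suc n ^ d
  length-levels d =
    trans (length-concat-applyUpTo (level d) (suc (n * d))) (∑<-length-level d (suc (n * d)) (n<1+n (n * d)))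

  -- prev stands for A n (suc e), which is known to agree with level (suc e) only pointwise.
  module _ (e : ℕ) (prev : ℕ → List (Vec ℕ (suc e))) (prev≗level : ∀ i → prev i ≡ level (suc e) i) where

    layer-prev : ∀ k c → c ≤ k → layer (level (suc e)) k c ≡ appendCol c (prev (k ∸ c))
    layer-prev k c c≤k = cong (appendCol c) (trans (shift-≤ (level (suc e)) c≤k) (sym (prev≗level (k ∸ c))))

    step-rising : ∀ {k} → k < n →
      concatMap (λ i → appendCol (k ∸ i) (prev i)) (upTo (suc k)) ≡ level (suc (suc e)) k
    step-rising {k} k<n = sym (concat-applyUpTo-trim _ _ (n ∸ k) (suc k) 0 n+1≡ empty middle (λ _ ()))
      where
      n+1≡ : suc n ≡ n ∸ k + suc k + 0
      n+1≡ = sym (trans (+-identityʳ _) (trans (+-suc (n ∸ k) k) (cong suc (m∸n+n≡m (<⇒≤ k<n)))))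
      empty : ∀ i → i < n ∸ k → layer (level (suc e)) k (n ∸ i) ≡ []
      empty i i<n∸k = cong (appendCol (n ∸ i)) (shift-> (level (suc e)) (m+n≤o⇒m≤o∸n (suc k)
        (subst (_≤ n) (cong suc (+-comm i k)) (m≤o∸n⇒m+n≤o (suc i) (<⇒≤ k<n) i<n∸k))))
      middle : ∀ i → i < suc k → layer (level (suc e)) k (n ∸ (n ∸ k + i)) ≡ appendCol (k ∸ i) (prev i)
      middle i i<1+k = begin
        layer (level (suc e)) k (n ∸ (n ∸ k + i))
          ≡⟨ cong (layer (level (suc e)) k) n∸[n∸k+i]≡k∸i ⟩
        layer (level (suc e)) k (k ∸ i)
          ≡⟨ layer-prev k (k ∸ i) (m∸n≤m k i) ⟩
        appendCol (k ∸ i) (prev (k ∸ (k ∸ i)))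
          ≡⟨ cong (appendCol (k ∸ i) ∘ prev) (m∸[m∸n]≡n (≤-pred i<1+k)) ⟩
        appendCol (k ∸ i) (prev i) ∎
        where
        n∸[n∸k+i]≡k∸i : n ∸ (n ∸ k + i) ≡ k ∸ i
        n∸[n∸k+i]≡k∸i = trans (sym (∸-+-assoc n (n ∸ k) i)) (cong (_∸ i) (m∸[m∸n]≡n (<⇒≤ k<n)))

    layer-top : ∀ {k j} → n ≤ k → j ≤ n →
      layer (level (suc e)) k (n ∸ j) ≡ appendCol (n ∸ j) (prev (k ∸ n + j))
    layer-top {k} {j} n≤k j≤n =
      trans (layer-prev k (n ∸ j) (≤-trans (m∸n≤m n j) n≤k)) (cong (appendCol (n ∸ j) ∘ prev) (begin
      k ∸ (n ∸ j)             ≡⟨ cong (_∸ (n ∸ j)) (m∸n+n≡m n≤k) ⟨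
      (k ∸ n + n) ∸ (n ∸ j)   ≡⟨ +-∸-assoc (k ∸ n) (m∸n≤m n j) ⟩
      k ∸ n + (n ∸ (n ∸ j))   ≡⟨ cong (k ∸ n +_) (m∸[m∸n]≡n j≤n) ⟩
      k ∸ n + j               ∎))

    step-middle : ∀ {k} → n ≤ k →
      concatMap (λ j → appendCol (n ∸ j) (prev (k ∸ n + j))) (upTo (suc n)) ≡ level (suc (suc e)) k
    step-middle n≤k = sym (concat-applyUpTo-trim _ _ 0 (suc n) 0 (sym (+-identityʳ (suc n)))
      (λ _ ()) (λ j j<1+n → layer-top n≤k (≤-pred j<1+n)) (λ _ ()))

    step-falling : ∀ {k} → n ≤ k → n * suc e < k → k < n * suc (suc e) →
      concatMap (λ j → appendCol (n ∸ j) (prev (k ∸ n + j))) (upTo (suc (n * suc (suc e) ∸ k)))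
        ≡ level (suc (suc e)) k
    step-falling {k} n≤k nE<k k<nD = sym (concat-applyUpTo-trim _ _ 0 (suc t) (n ∸ t) n+1≡ (λ _ ())
      (λ j j<1+t → layer-top n≤k (≤-trans (≤-pred j<1+t) (<⇒≤ t<n))) empty)
      where
      nE nD t : ℕ
      nE = n * suc e
      nD = n * suc (suc e)
      t  = nD ∸ k
      nD≡n+nE : nD ≡ n + nE
      nD≡n+nE = *-suc n (suc e)
      t<n : t < n
      t<n = subst (t <_) (trans (cong (_∸ nE) nD≡n+nE) (m+n∸n≡m n nE)) (∸-monoʳ-< nE<k (<⇒≤ k<nD))
      n+1≡ : suc n ≡ suc t + (n ∸ t)
      n+1≡ = cong suc (sym (m+[n∸m]≡n (<⇒≤ t<n)))
      nE+[n∸t]≡k : nE + (n ∸ t) ≡ k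
      nE+[n∸t]≡k = +-cancelʳ-≡ t _ _ (begin
        nE + (n ∸ t) + t  ≡⟨ +-assoc nE (n ∸ t) t ⟩
        nE + (n ∸ t + t)  ≡⟨ cong (nE +_) (m∸n+n≡m (<⇒≤ t<n)) ⟩
        nE + n            ≡⟨ +-comm nE n ⟩
        n + nE            ≡⟨ nD≡n+nE ⟨
        nD                ≡⟨ m+[n∸m]≡n (<⇒≤ k<nD) ⟨
        k + t             ∎)
      empty : ∀ i → i < n ∸ t → layer (level (suc e)) k (n ∸ (suc t + i)) ≡ []
      empty i _ = layer-below (suc e) k (≤-trans (s≤s (+-monoʳ-≤ nE (∸-monoʳ-≤ n (m≤m+n (suc t) i))))
        (≤-reflexive (begin
          suc (nE + (n ∸ suc t)) ≡⟨ +-suc nE (n ∸ suc t) ⟨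
          nE + suc (n ∸ suc t)   ≡⟨ cong (nE +_) (+-∸-assoc 1 t<n) ⟨
          nE + (n ∸ t)           ≡⟨ nE+[n∸t]≡k ⟩
          k                      ∎)))

    step≗level : ∀ k → step n (suc e) prev k ≡ level (suc (suc e)) k
    step≗level zero = sym (level-zero (suc (suc e)))
    step≗level k@(suc _) with k <ᵇ n | <ᵇ-reflects-< k n
    ... | true  | ofʸ k<n = step-rising k<n
    ... | false | ofⁿ k≮n with k ≤ᵇ n * suc (suc e) ∸ n | ≤ᵇ-reflects-≤ k (n * suc (suc e) ∸ n)
    ...   | true  | ofʸ _   = step-middle (≮⇒≥ k≮n)
    ...   | false | ofⁿ k≰  with k <ᵇ n * suc (suc e) | <ᵇ-reflects-< k (n * suc (suc e))
    ...     | true  | ofʸ k<nD = step-falling (≮⇒≥ k≮n) nE<k k<nD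
      where
      nE<k : n * suc e < k
      nE<k = subst (_< k) (trans (cong (_∸ n) (*-suc n (suc e))) (m+n∸m≡n n (n * suc e))) (≰⇒> k≰)
    ...     | false | ofⁿ k≮nD
      with k ≡ᵇ n * suc (suc e) | fromEquivalence (≡ᵇ⇒≡ k (n * suc (suc e))) (≡⇒≡ᵇ k _)
    ...       | true  | ofʸ k≡nD  = sym (trans (cong (level (suc (suc e))) k≡nD) (level-full (suc (suc e))))
    ...       | false | ofⁿ k≢nD  = sym (level-empty (suc (suc e)) (≤∧≢⇒< (≮⇒≥ k≮nD) (k≢nD ∘ sym)))

  A≗level : ∀ e k → A n (suc e) k ≡ level (suc e) k
  A≗level zero k with k ≤ᵇ n | ≤ᵇ-reflects-≤ k n
  ... | true  | ofʸ k≤n = sym (level-one k≤n)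
  ... | false | ofⁿ k≰n = sym (level-empty 1 (subst (_< k) (sym (*-identityʳ n)) (≰⇒> k≰n)))
  A≗level (suc e) = step≗level e (A n (suc e)) (A≗level e)

  H≡levels : ∀ e → H n (suc e) ≡ levels (suc e)
  H≡levels e = cong concat (trans (map-upTo (A n (suc e)) (suc (n * suc e)))
    (applyUpTo-cong (suc (n * suc e)) (λ k _ → A≗level e k)))

mainTheorem1 : (n d : ℕ) → 2 ≤ n → 1 ≤ d →
    (∀ (v : Vec ℕ d) → VAll.All (_≤ n) v → v ∈ H n d)
    × All (VAll.All (_≤ n)) (H n d)
    × Linked _<H_ (H n d)
    × length (H n d) ≡ (n + 1) ^ d
mainTheorem1 n zero    _ ()
mainTheorem1 n (suc e) _ _ = subst Conclusion (sym (H≡levels e))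
  ( levels-complete
  , levels-vertices (suc e)
  , AllPairs⇒Linked (levels-sorted (suc e))
  , trans (length-levels (suc e)) (cong (_^ suc e) (+-comm 1 n)) )
  where
  open Levels n
  Conclusion : List (Vec ℕ (suc e)) → Set
  Conclusion L = (∀ v → Vertex v → v ∈ L) × All Vertex L × Linked _<H_ L × length L ≡ (n + 1) ^ suc e
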